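{- Let $M,N\geq 0$ and $k\geq 1$ be integers with $|M-N|\leq k$. The number of pairs $(u,v)$ of binary words with $u\in\mathscr{M}_{M,N}$ and $v\in\mathscr{M}_{N,M}$ such that $$-k<\sum_{j\leq s}(u_j-v_j)<k\quad\text{for all } s=1,\ldots,M+N$$ is equal to $$\sum_{l\in\mathbb{Z}}\binom{M+N}{M-kl}^2(-1)^l .$$
   Context: A binary word is a finite word $u=u_1u_2\cdots u_n$ on the alphabet $\{0,1\}$. For integers $m,n\geq 0$, $\mathscr{M}_{m,n}$ denotes the set of binary words with exactly $m$ letters equal to $1$ and exactly $n$ letters equal to $0$ (so these words have length $m+n$). Binomial coefficients $\binom{n}{j}$ are $0$ when $j<0$ or $j>n$. -}

module Defs where

open import Data.Bool using (Bool; true; false)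
open import Data.Nat using (ℕ; zero; suc; _+_; _∸_; _%_)
open import Data.Nat.Combinatorics using (_C_)
open import Data.Integer as ℤ using (ℤ; +_; -[1+_]; -_; _-_; _*_; _<_; _<?_)
open import Data.List as List using (List; []; _∷_; length; filter; cartesianProduct; concatMap; upTo)
open import Data.List.Relation.Unary.All using (All; all?)
open import Data.Vec as Vec using (Vec; []; _∷_; toList)
open import Data.Product using (_×_; _,_; proj₁; proj₂)
open import Relation.Binary.PropositionalEquality using (_≡_)
open import Relation.Nullary.Decidable using (Dec; _×-dec_)
import Data.Nat.Properties as ℕP

ones : ∀ {n} → Vec Bool n → ℕ
ones []           = 0
ones (true  ∷ w)  = suc (ones w)
ones (false ∷ w)  = ones w

val : Bool → ℤ
val true  = + 1
val false = + 0

psum : List Bool → List Bool → ℕ → ℤ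
psum (a ∷ as) (b ∷ bs) (suc s) = (val a - val b) ℤ.+ psum as bs s
psum _        _        _       = + 0

allWords : (n : ℕ) → List (Vec Bool n)
allWords zero    = [] ∷ []
allWords (suc n) = concatMap (λ w → (false ∷ w) ∷ (true ∷ w) ∷ []) (allWords n)

InM : (m n : ℕ) → Vec Bool (m + n) → Set
InM m n w = ones w ≡ m

Bounded : (k L : ℕ) → List Bool → List Bool → Set
Bounded k L u v =
  All (λ s → (- (+ k) < psum u v s) × (psum u v s < + k)) (List.map suc (upTo L))

Good : (M N k : ℕ) → Vec Bool (M + N) × Vec Bool (N + M) → Set
Good M N k (u , v) = InM M N u × InM N M v × Bounded k (M + N) (toList u) (toList v)

good? : (M N k : ℕ) → (p : Vec Bool (M + N) × Vec Bool (N + M)) → Dec (Good M N k p)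
good? M N k (u , v) =
  (ones u ℕP.≟ M) ×-dec ((ones v ℕP.≟ N) ×-dec
    all? (λ s → (- (+ k) <? psum (toList u) (toList v) s) ×-dec (psum (toList u) (toList v) s <? + k))
         (List.map suc (upTo (M + N))))

count : (M N k : ℕ) → ℕ
count M N k = length (filter (good? M N k) (cartesianProduct (allWords (M + N)) (allWords (N + M))))

-- binomial coefficient with integer lower index: 0 if j < 0 (and 0 if j > n, by _C_)
binomℤ : ℕ → ℤ → ℕ
binomℤ n (+ j)     = n C j
binomℤ n -[1+ j ]  = 0

signℤ : ℤ → ℤ
signℤ l with ℤ.∣ l ∣ % 2
... | zero = + 1
... | suc _ = - (+ 1)

term : (M N k : ℕ) → ℤ → ℤ
term M N k l = (+ (binomℤ (M + N) (+ M - (+ k) * l))) * (+ (binomℤ (M + N) (+ M - (+ k) * l))) * signℤ l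

symSum : ℕ → (ℤ → ℤ) → ℤ
symSum L f = List.foldr ℤ._+_ (+ 0) (List.map (λ i → f (+ i - + L)) (upTo (suc (L + L))))

module Submission where

-- Read a pair (u , v) letter by letter as a walk on ℤ: the height after s
-- letters is Σ_{j≤s} (u_j - v_j), and the pair is counted when the walk stays
-- in the open band (-k , k).  For a walk that still has to read n letters of
-- each word, of which a resp. b are ones, starting at height d, let
-- walks n a b d be the number of admissible continuations, and compare it with
-- the reflection-principle expression
--   F n a b d = Σ_j [ C(n, a-2kj) C(n, b+2kj) - C(n, a-k+d-2kj) C(n, b+k-d+2kj) ],
-- with j ranging over a window wide enough to contain every nonzero term.  Both
-- satisfy the same four-term recursion in n (for walks: split off the first
-- letters; for F: Pascal's rule, the mirror term trading the two mixed moves),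
-- F vanishes on the barriers d = ±k (at -k because the mirror term is the kernel
-- shifted by one index, so the sum telescopes), and both agree for n = 0.
-- Hence walks = F by induction on n.  Finally the sum Σ_l C(M+N, M-kl)² (-1)^l
-- of the statement is F (M+N) M N 0 once its even and odd indices are paired.

open import Defs
open import Data.Nat using (ℕ; _+_; _≤_)
open import Data.Integer using (+_; _-_; ∣_∣)
open import Relation.Binary.PropositionalEquality using (_≡_)

open import Data.Nat as ℕ using (zero; suc; z≤n; s≤s)
import Data.Nat.Properties as ℕP
import Data.Nat.DivMod as ℕDM
open import Data.Nat.Combinatorics using (_C_)
import Data.Nat.Combinatorics as ℕC
import Data.Nat.Tactic.RingSolver as ℕSolver
open import Data.Integer using (ℤ; -[1+_]; -_; _*_; _<_; +≤+; -≤+; +<+)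
  renaming (_+_ to _+ᶻ_; _≤_ to _≤ᶻ_)
import Data.Integer.Properties as ℤP
open import Data.Integer.Tactic.RingSolver using (solve-∀)
open import Data.Bool using (Bool; true; false)
open import Data.Product using (_×_; _,_; proj₁; proj₂)
open import Data.Sum using (_⊎_; inj₁; inj₂)
open import Data.Empty using (⊥-elim)
open import Data.Unit using (⊤; tt)
open import Data.List as List using (List; []; _∷_; _++_)
open import Data.Vec using (Vec; []; _∷_; toList)
import Data.List.Properties as ListP
open import Data.List.Relation.Unary.All using (All)
import Data.List.Relation.Unary.All.Properties as AllP
open import Relation.Nullary using (¬_; Dec; yes; no)
open import Relation.Nullary.Decidable using (_×-dec_)
open import Relation.Binary.PropositionalEquality
  using (refl; sym; trans; cong; cong₂; subst; module ≡-Reasoning)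

sumFrom : ℕ → (ℤ → ℤ) → ℤ → ℤ
sumFrom zero    g s = + 0
sumFrom (suc m) g s = g s +ᶻ sumFrom m g (s +ᶻ + 1)

Σw : ℕ → (ℤ → ℤ) → ℤ
Σw L g = sumFrom (suc (L + L)) g (- + L)

sumFrom-cong : ∀ m {f g : ℤ → ℤ} → (∀ j → f j ≡ g j) → ∀ s → sumFrom m f s ≡ sumFrom m g s
sumFrom-cong zero    f≡g s = refl
sumFrom-cong (suc m) f≡g s = cong₂ _+ᶻ_ (f≡g s) (sumFrom-cong m f≡g (s +ᶻ + 1))

sumFrom-+ : ∀ m (f g : ℤ → ℤ) s →
  sumFrom m (λ j → f j +ᶻ g j) s ≡ sumFrom m f s +ᶻ sumFrom m g s
sumFrom-+ zero    f g s = refl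
sumFrom-+ (suc m) f g s =
  trans (cong (f s +ᶻ g s +ᶻ_) (sumFrom-+ m f g (s +ᶻ + 1)))
    (interchange (f s) (g s) (sumFrom m f (s +ᶻ + 1)) (sumFrom m g (s +ᶻ + 1)))
  where
  interchange : ∀ a b c d → (a +ᶻ b) +ᶻ (c +ᶻ d) ≡ (a +ᶻ c) +ᶻ (b +ᶻ d)
  interchange = solve-∀

sumFrom-zero : ∀ m s → sumFrom m (λ _ → + 0) s ≡ + 0
sumFrom-zero zero    s = refl
sumFrom-zero (suc m) s = trans (ℤP.+-identityˡ _) (sumFrom-zero m (s +ᶻ + 1))

sumFrom-snoc : ∀ m (g : ℤ → ℤ) s → sumFrom (suc m) g s ≡ sumFrom m g s +ᶻ g (s +ᶻ + m)
sumFrom-snoc zero    g s = trans (ℤP.+-identityʳ (g s))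
  (trans (cong g (sym (ℤP.+-identityʳ s))) (sym (ℤP.+-identityˡ _)))
sumFrom-snoc (suc m) g s = begin
    g s +ᶻ sumFrom (suc m) g (s +ᶻ + 1)
  ≡⟨ cong (g s +ᶻ_) (sumFrom-snoc m g (s +ᶻ + 1)) ⟩
    g s +ᶻ (sumFrom m g (s +ᶻ + 1) +ᶻ g (s +ᶻ + 1 +ᶻ + m))
  ≡⟨ sym (ℤP.+-assoc (g s) _ _) ⟩
    g s +ᶻ sumFrom m g (s +ᶻ + 1) +ᶻ g (s +ᶻ + 1 +ᶻ + m)
  ≡⟨ cong (λ t → g s +ᶻ sumFrom m g (s +ᶻ + 1) +ᶻ g t) (shift s (+ m)) ⟩
    g s +ᶻ sumFrom m g (s +ᶻ + 1) +ᶻ g (s +ᶻ + suc m) ∎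
  where
  open ≡-Reasoning
  shift : ∀ s m → s +ᶻ + 1 +ᶻ m ≡ s +ᶻ (+ 1 +ᶻ m)
  shift = solve-∀

sumFrom-telescope : ∀ m (g : ℤ → ℤ) s → sumFrom m (λ j → g j - g (j +ᶻ + 1)) s ≡ g s - g (s +ᶻ + m)
sumFrom-telescope zero    g s =
  trans (sym (ℤP.+-inverseʳ (g s))) (cong (λ t → g s - g t) (sym (ℤP.+-identityʳ s)))
sumFrom-telescope (suc m) g s = begin
    g s - g (s +ᶻ + 1) +ᶻ sumFrom m (λ j → g j - g (j +ᶻ + 1)) (s +ᶻ + 1)
  ≡⟨ cong (g s - g (s +ᶻ + 1) +ᶻ_) (sumFrom-telescope m g (s +ᶻ + 1)) ⟩
    g s - g (s +ᶻ + 1) +ᶻ (g (s +ᶻ + 1) - g (s +ᶻ + 1 +ᶻ + m))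
  ≡⟨ cancel (g s) (g (s +ᶻ + 1)) (g (s +ᶻ + 1 +ᶻ + m)) ⟩
    g s - g (s +ᶻ + 1 +ᶻ + m)
  ≡⟨ cong (λ t → g s - g t) (shift s (+ m)) ⟩
    g s - g (s +ᶻ + suc m) ∎
  where
  open ≡-Reasoning
  cancel : ∀ a b c → a - b +ᶻ (b - c) ≡ a - c
  cancel = solve-∀
  shift : ∀ s m → s +ᶻ + 1 +ᶻ m ≡ s +ᶻ (+ 1 +ᶻ m)
  shift = solve-∀

sumFrom-pairs : ∀ m (g : ℤ → ℤ) s →
  sumFrom (m + m) g (s +ᶻ s) ≡ sumFrom m (λ i → g (i +ᶻ i) +ᶻ g (i +ᶻ i +ᶻ + 1)) s
sumFrom-pairs zero    g s = refl
sumFrom-pairs (suc m) g s = begin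
    g (s +ᶻ s) +ᶻ sumFrom (m + suc m) g (s +ᶻ s +ᶻ + 1)
  ≡⟨ cong (λ n → g (s +ᶻ s) +ᶻ sumFrom n g (s +ᶻ s +ᶻ + 1)) (ℕP.+-suc m m) ⟩
    g (s +ᶻ s) +ᶻ (g (s +ᶻ s +ᶻ + 1) +ᶻ sumFrom (m + m) g (s +ᶻ s +ᶻ + 1 +ᶻ + 1))
  ≡⟨ cong (λ t → g (s +ᶻ s) +ᶻ (g (s +ᶻ s +ᶻ + 1) +ᶻ sumFrom (m + m) g t)) (double-suc s) ⟩
    g (s +ᶻ s) +ᶻ (g (s +ᶻ s +ᶻ + 1) +ᶻ sumFrom (m + m) g (s +ᶻ + 1 +ᶻ (s +ᶻ + 1)))
  ≡⟨ cong (λ t → g (s +ᶻ s) +ᶻ (g (s +ᶻ s +ᶻ + 1) +ᶻ t)) (sumFrom-pairs m g (s +ᶻ + 1)) ⟩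
    g (s +ᶻ s) +ᶻ (g (s +ᶻ s +ᶻ + 1) +ᶻ sumFrom m (λ i → g (i +ᶻ i) +ᶻ g (i +ᶻ i +ᶻ + 1)) (s +ᶻ + 1))
  ≡⟨ sym (ℤP.+-assoc (g (s +ᶻ s)) _ _) ⟩
    g (s +ᶻ s) +ᶻ g (s +ᶻ s +ᶻ + 1) +ᶻ sumFrom m (λ i → g (i +ᶻ i) +ᶻ g (i +ᶻ i +ᶻ + 1)) (s +ᶻ + 1) ∎
  where
  open ≡-Reasoning
  double-suc : ∀ s → s +ᶻ s +ᶻ + 1 +ᶻ + 1 ≡ s +ᶻ + 1 +ᶻ (s +ᶻ + 1)
  double-suc = solve-∀

Σw-cong : ∀ L {f g : ℤ → ℤ} → (∀ j → f j ≡ g j) → Σw L f ≡ Σw L g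
Σw-cong L f≡g = sumFrom-cong (suc (L + L)) f≡g (- + L)

Σw-zero : ∀ L → Σw L (λ _ → + 0) ≡ + 0
Σw-zero L = sumFrom-zero (suc (L + L)) (- + L)

Supported : ℕ → (ℤ → ℤ) → Set
Supported W g = ∀ j → W ℕ.< ∣ j ∣ → g j ≡ + 0

Σw-suc : ∀ L (g : ℤ → ℤ) → Σw (suc L) g ≡ g (- + suc L) +ᶻ Σw L g +ᶻ g (+ suc L)
Σw-suc L g = begin
    g (- + suc L) +ᶻ sumFrom (suc (L + suc L)) g (- + suc L +ᶻ + 1)
  ≡⟨ cong (λ n → g (- + suc L) +ᶻ sumFrom (suc n) g (- + suc L +ᶻ + 1)) (ℕP.+-suc L L) ⟩
    g (- + suc L) +ᶻ sumFrom (suc (suc (L + L))) g (- + suc L +ᶻ + 1)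
  ≡⟨ cong (λ t → g (- + suc L) +ᶻ sumFrom (suc (suc (L + L))) g t) (left-end (+ L)) ⟩
    g (- + suc L) +ᶻ sumFrom (suc (suc (L + L))) g (- + L)
  ≡⟨ cong (g (- + suc L) +ᶻ_) (sumFrom-snoc (suc (L + L)) g (- + L)) ⟩
    g (- + suc L) +ᶻ (Σw L g +ᶻ g (- + L +ᶻ + suc (L + L)))
  ≡⟨ sym (ℤP.+-assoc (g (- + suc L)) (Σw L g) _) ⟩
    g (- + suc L) +ᶻ Σw L g +ᶻ g (- + L +ᶻ + suc (L + L))
  ≡⟨ cong (λ t → g (- + suc L) +ᶻ Σw L g +ᶻ g t) (right-end (+ L)) ⟩
    g (- + suc L) +ᶻ Σw L g +ᶻ g (+ suc L) ∎
  where
  open ≡-Reasoning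
  left-end : ∀ x → - (+ 1 +ᶻ x) +ᶻ + 1 ≡ - x
  left-end = solve-∀
  right-end : ∀ x → - x +ᶻ (+ 1 +ᶻ (x +ᶻ x)) ≡ + 1 +ᶻ x
  right-end = solve-∀

Σw-extend : ∀ {W} (g : ℤ → ℤ) → Supported W g → ∀ t → Σw (W + t) g ≡ Σw W g
Σw-extend {W} g supp zero = cong (λ n → Σw n g) (ℕP.+-identityʳ W)
Σw-extend {W} g supp (suc t) = begin
    Σw (W + suc t) g
  ≡⟨ cong (λ n → Σw n g) (ℕP.+-suc W t) ⟩
    Σw (suc (W + t)) g
  ≡⟨ Σw-suc (W + t) g ⟩
    g (- + suc (W + t)) +ᶻ Σw (W + t) g +ᶻ g (+ suc (W + t))
  ≡⟨ cong₂ (λ x y → x +ᶻ Σw (W + t) g +ᶻ y) (supp _ outside) (supp _ outside) ⟩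
    + 0 +ᶻ Σw (W + t) g +ᶻ + 0
  ≡⟨ trans (ℤP.+-identityʳ _) (ℤP.+-identityˡ _) ⟩
    Σw (W + t) g
  ≡⟨ Σw-extend g supp t ⟩
    Σw W g ∎
  where
  open ≡-Reasoning
  outside : W ℕ.< suc (W + t)
  outside = s≤s (ℕP.m≤m+n W t)

Σw-window : ∀ {W L} (g : ℤ → ℤ) → Supported W g → W ≤ L → Σw L g ≡ Σw W g
Σw-window {W} {L} g supp W≤L =
  trans (cong (λ n → Σw n g) (sym (ℕP.m+[n∸m]≡n W≤L))) (Σw-extend g supp (L ℕ.∸ W))

Σw-telescope : ∀ {W L} (g : ℤ → ℤ) → Supported W g → W ℕ.< L →
  Σw L (λ j → g j - g (j +ᶻ + 1)) ≡ + 0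
Σw-telescope {W} {L} g supp W<L = begin
    Σw L (λ j → g j - g (j +ᶻ + 1))
  ≡⟨ sumFrom-telescope (suc (L + L)) g (- + L) ⟩
    g (- + L) - g (- + L +ᶻ + suc (L + L))
  ≡⟨ cong (λ t → g (- + L) - g t) (right-end (+ L)) ⟩
    g (- + L) - g (+ suc L)
  ≡⟨ cong₂ _-_ (supp (- + L) (subst (W ℕ.<_) (sym (ℤP.∣-i∣≡∣i∣ (+ L))) W<L))
               (supp (+ suc L) (ℕP.m≤n⇒m≤1+n W<L)) ⟩
    + 0 ∎
  where
  open ≡-Reasoning
  right-end : ∀ x → - x +ᶻ (+ 1 +ᶻ (x +ᶻ x)) ≡ + 1 +ᶻ x
  right-end = solve-∀

Σw-pairs : ∀ L (g : ℤ → ℤ) →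
  Σw (suc (L + L)) g ≡ g (- + suc (L + L)) +ᶻ Σw L (λ i → g (i +ᶻ i) +ᶻ g (i +ᶻ i +ᶻ + 1))
Σw-pairs L g = cong (g (- + suc (L + L)) +ᶻ_)
  (trans (cong (sumFrom (suc (L + L) + suc (L + L)) g) (left-end (+ L)))
         (sumFrom-pairs (suc (L + L)) g (- + L)))
  where
  left-end : ∀ x → - (+ 1 +ᶻ (x +ᶻ x)) +ᶻ + 1 ≡ - x +ᶻ - x
  left-end = solve-∀

symSum≡Σw : ∀ L (f : ℤ → ℤ) → symSum L f ≡ Σw L f
symSum≡Σw L f = trans (cong (List.foldr _+ᶻ_ (+ 0)) (ListP.map-upTo (λ i → f (+ i - + L)) (suc (L + L))))
  (foldr-applyUpTo _ (suc (L + L)) (- + L) (λ i → cong f (reindex (+ i) (+ L))))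
  where
  reindex : ∀ i L → i - L ≡ - L +ᶻ i
  reindex = solve-∀
  foldr-applyUpTo : ∀ (h : ℕ → ℤ) m s → (∀ i → h i ≡ f (s +ᶻ + i)) →
    List.foldr _+ᶻ_ (+ 0) (List.applyUpTo h m) ≡ sumFrom m f s
  foldr-applyUpTo h zero    s eq = refl
  foldr-applyUpTo h (suc m) s eq = cong₂ _+ᶻ_ (trans (eq 0) (cong f (ℤP.+-identityʳ s)))
    (foldr-applyUpTo (λ i → h (suc i)) m (s +ᶻ + 1) (λ i → trans (eq (suc i)) (cong f (assoc s (+ i)))))
    where
    assoc : ∀ s i → s +ᶻ (+ 1 +ᶻ i) ≡ s +ᶻ + 1 +ᶻ i
    assoc = solve-∀

Σ₂ : (Bool → ℤ) → ℤ
Σ₂ f = f false +ᶻ f true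

Σ₄ : (Bool → Bool → ℤ) → ℤ
Σ₄ f = Σ₂ (λ x → Σ₂ (f x))

Σ₂-cong : ∀ {f g : Bool → ℤ} → (∀ x → f x ≡ g x) → Σ₂ f ≡ Σ₂ g
Σ₂-cong f≡g = cong₂ _+ᶻ_ (f≡g false) (f≡g true)

Σ₄-cong : ∀ {f g : Bool → Bool → ℤ} → (∀ x y → f x y ≡ g x y) → Σ₄ f ≡ Σ₄ g
Σ₄-cong f≡g = Σ₂-cong (λ x → Σ₂-cong (f≡g x))

Σ₂-* : ∀ (f g : Bool → ℤ) → Σ₂ f * Σ₂ g ≡ Σ₄ (λ x y → f x * g y)
Σ₂-* f g = expand (f false) (f true) (g false) (g true)
  where
  expand : ∀ a b c d → (a +ᶻ b) * (c +ᶻ d) ≡ a * c +ᶻ a * d +ᶻ (b * c +ᶻ b * d)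
  expand = solve-∀

Σ₄-swap-sub : ∀ (f g : Bool → Bool → ℤ) → Σ₄ f - Σ₄ g ≡ Σ₄ (λ x y → f x y - g y x)
Σ₄-swap-sub f g = regroup (f false false) (f false true) (f true false) (f true true)
                          (g false false) (g false true) (g true false) (g true true)
  where
  regroup : ∀ a b c d a' b' c' d' →
    (a +ᶻ b +ᶻ (c +ᶻ d)) - (a' +ᶻ b' +ᶻ (c' +ᶻ d')) ≡ a - a' +ᶻ (b - c') +ᶻ (c - b' +ᶻ (d - d'))
  regroup = solve-∀

Additive : {A : Set} → ((A → ℤ) → ℤ) → Set
Additive {A} S = ∀ (f g : A → ℤ) → S (λ a → f a +ᶻ g a) ≡ S f +ᶻ S g

Σ₂-commute : ∀ {A : Set} {S : (A → ℤ) → ℤ} → Additive S →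
  ∀ (f : A → Bool → ℤ) → S (λ a → Σ₂ (f a)) ≡ Σ₂ (λ x → S (λ a → f a x))
Σ₂-commute add f = add (λ a → f a false) (λ a → f a true)

Σ₄-commute : ∀ {A : Set} {S : (A → ℤ) → ℤ} → Additive S →
  ∀ (f : A → Bool → Bool → ℤ) → S (λ a → Σ₄ (f a)) ≡ Σ₄ (λ x y → S (λ a → f a x y))
Σ₄-commute {S = S} add f = trans (Σ₂-commute {S = S} add (λ a x → Σ₂ (f a x)))
                                 (Σ₂-cong (λ x → Σ₂-commute {S = S} add (λ a → f a x)))

Σw-additive : ∀ L → Additive (Σw L)
Σw-additive L f g = sumFrom-+ (suc (L + L)) f g (- + L)

Σl : ∀ {A : Set} → List A → (A → ℤ) → ℤ
Σl []       f = + 0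
Σl (x ∷ xs) f = f x +ᶻ Σl xs f

Σl-cong : ∀ {A : Set} (xs : List A) {f g : A → ℤ} → (∀ x → f x ≡ g x) → Σl xs f ≡ Σl xs g
Σl-cong []       f≡g = refl
Σl-cong (x ∷ xs) f≡g = cong₂ _+ᶻ_ (f≡g x) (Σl-cong xs f≡g)

Σl-additive : ∀ {A : Set} (xs : List A) → Additive (Σl xs)
Σl-additive []       f g = refl
Σl-additive (x ∷ xs) f g =
  trans (cong (f x +ᶻ g x +ᶻ_) (Σl-additive xs f g)) (interchange (f x) (g x) (Σl xs f) (Σl xs g))
  where
  interchange : ∀ a b c d → (a +ᶻ b) +ᶻ (c +ᶻ d) ≡ (a +ᶻ c) +ᶻ (b +ᶻ d)
  interchange = solve-∀

Σl-scale : ∀ {A : Set} (xs : List A) c f → Σl xs (λ x → c * f x) ≡ c * Σl xs f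
Σl-scale []       c f = sym (ℤP.*-zeroʳ c)
Σl-scale (x ∷ xs) c f =
  trans (cong (c * f x +ᶻ_) (Σl-scale xs c f)) (sym (ℤP.*-distribˡ-+ c (f x) (Σl xs f)))

Σl-++ : ∀ {A : Set} (xs ys : List A) f → Σl (xs ++ ys) f ≡ Σl xs f +ᶻ Σl ys f
Σl-++ []       ys f = sym (ℤP.+-identityˡ _)
Σl-++ (x ∷ xs) ys f = trans (cong (f x +ᶻ_) (Σl-++ xs ys f)) (sym (ℤP.+-assoc (f x) _ _))

Σl-map : ∀ {A B : Set} (g : A → B) (xs : List A) f → Σl (List.map g xs) f ≡ Σl xs (λ x → f (g x))
Σl-map g []       f = refl
Σl-map g (x ∷ xs) f = cong (f (g x) +ᶻ_) (Σl-map g xs f)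

Σl-concatMap : ∀ {A B : Set} (h : A → List B) (xs : List A) f →
  Σl (List.concatMap h xs) f ≡ Σl xs (λ x → Σl (h x) f)
Σl-concatMap h []       f = refl
Σl-concatMap h (x ∷ xs) f =
  trans (Σl-++ (h x) (List.concatMap h xs) f) (cong (Σl (h x) f +ᶻ_) (Σl-concatMap h xs f))

Σl-cartesianProduct : ∀ {A B : Set} (xs : List A) (ys : List B) f →
  Σl (List.cartesianProduct xs ys) f ≡ Σl xs (λ x → Σl ys (λ y → f (x , y)))
Σl-cartesianProduct []       ys f = refl
Σl-cartesianProduct (x ∷ xs) ys f = trans (Σl-++ (List.map (x ,_) ys) _ f)
  (cong₂ _+ᶻ_ (Σl-map (x ,_) ys f) (Σl-cartesianProduct xs ys f))

Σl-allWords : ∀ n (g : Vec Bool (suc n) → ℤ) →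
  Σl (allWords (suc n)) g ≡ Σ₂ (λ x → Σl (allWords n) (λ w → g (x ∷ w)))
Σl-allWords n g =
  trans (Σl-concatMap _ (allWords n) g)
  (trans (Σl-cong (allWords n) (λ w → cong (g (false ∷ w) +ᶻ_) (ℤP.+-identityʳ _)))
         (Σl-additive (allWords n) (λ w → g (false ∷ w)) (λ w → g (true ∷ w))))

ind : ∀ {P : Set} → Dec P → ℤ
ind (yes _) = + 1
ind (no _)  = + 0

ind-yes : ∀ {P : Set} → P → (P? : Dec P) → ind P? ≡ + 1
ind-yes p (yes _) = refl
ind-yes p (no ¬p) = ⊥-elim (¬p p)

ind-no : ∀ {P : Set} → ¬ P → (P? : Dec P) → ind P? ≡ + 0
ind-no ¬p (yes p) = ⊥-elim (¬p p)
ind-no ¬p (no _)  = refl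

ind-⇔ : ∀ {P Q : Set} → (P → Q) → (Q → P) → (P? : Dec P) (Q? : Dec Q) → ind P? ≡ ind Q?
ind-⇔ to from (yes p) Q? = sym (ind-yes (to p) Q?)
ind-⇔ to from (no ¬p) Q? = sym (ind-no (λ q → ¬p (from q)) Q?)

ind-× : ∀ {P Q : Set} (P? : Dec P) (Q? : Dec Q) → ind (P? ×-dec Q?) ≡ ind P? * ind Q?
ind-× (yes _) (yes _) = refl
ind-× (yes _) (no _)  = refl
ind-× (no _)  (yes _) = refl
ind-× (no _)  (no _)  = refl

length-filter : ∀ {A : Set} {P : A → Set} (P? : ∀ x → Dec (P x)) (xs : List A) →
  + List.length (List.filter P? xs) ≡ Σl xs (λ x → ind (P? x))
length-filter P? []       = refl
length-filter P? (x ∷ xs) with P? x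
... | yes _ = cong (+ 1 +ᶻ_) (length-filter P? xs)
... | no _  = trans (length-filter P? xs) (sym (ℤP.+-identityˡ _))

Cz : ℕ → ℤ → ℤ
Cz n x = + binomℤ n x

Cz-neg : ∀ n {x} → x < + 0 → Cz n x ≡ + 0
Cz-neg n { -[1+ m ]} _        = refl
Cz-neg n {+ m}       (+<+ ())

Cz-big : ∀ n j → n ℕ.< j → Cz n (+ j) ≡ + 0
Cz-big n j n<j = cong +_ (ℕC.k>n⇒nCk≡0 n<j)

Cz-sym : ∀ n x → Cz n x ≡ Cz n (+ n - x)
Cz-sym n -[1+ m ] = sym (Cz-big n (n + suc m) (ℕP.m<m+n n (s≤s z≤n)))
Cz-sym n (+ j) with ℕP.≤-<-connex j n
... | inj₁ j≤n = trans (cong +_ (ℕC.nCk≡nC[n∸k] j≤n))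
                       (cong (Cz n) (sym (trans (ℤP.m-n≡m⊖n n j) (ℤP.⊖-≥ j≤n))))
... | inj₂ n<j = trans (Cz-big n j n<j)
                       (sym (trans (cong (Cz n) (trans (ℤP.m-n≡m⊖n n j) (ℤP.⊖-< n<j)))
                                   (Cz-neg n (ℤP.neg-mono-< (+<+ (ℕP.m<n⇒0<n∸m n<j))))))

Cz-pascal : ∀ n x → Cz (suc n) x ≡ Σ₂ (λ b → Cz n (x - val b))
Cz-pascal n x = trans (pascal x) (cong (λ y → Cz n y +ᶻ Cz n (x - + 1)) (sym (ℤP.+-identityʳ x)))
  where
  pred-suc : ∀ y → + 1 +ᶻ y - + 1 ≡ y
  pred-suc = solve-∀
  pascal : ∀ x → Cz (suc n) x ≡ Cz n x +ᶻ Cz n (x - + 1)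
  pascal (+ zero)   = refl
  pascal (+ suc m)  = trans (cong +_ (trans (sym (ℕC.nCk+nC[k+1]≡[n+1]C[k+1] n m))
                                            (ℕP.+-comm (n C m) (n C suc m))))
                            (cong (λ y → + (n C suc m) +ᶻ Cz n y) (sym (pred-suc (+ m))))
  pascal -[1+ m ]   = refl

Cz-zero : ∀ x → Cz 0 x ≡ + 0 ⊎ x ≡ + 0
Cz-zero (+ zero)  = inj₂ refl
Cz-zero (+ suc m) = inj₁ refl
Cz-zero -[1+ m ]  = inj₁ refl

T : ℕ → ℤ → ℤ → ℤ → ℤ → ℤ
T n σ p q j = Cz n (p - σ * j) * Cz n (q +ᶻ σ * j)

T-pascal : ∀ n σ p q j → T (suc n) σ p q j ≡ Σ₄ (λ x y → T n σ (p - val x) (q - val y) j)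
T-pascal n σ p q j = begin
    Cz (suc n) (p - σ * j) * Cz (suc n) (q +ᶻ σ * j)
  ≡⟨ cong₂ _*_ (Cz-pascal n (p - σ * j)) (Cz-pascal n (q +ᶻ σ * j)) ⟩
    Σ₂ (λ x → Cz n (p - σ * j - val x)) * Σ₂ (λ y → Cz n (q +ᶻ σ * j - val y))
  ≡⟨ Σ₂-* (λ x → Cz n (p - σ * j - val x)) (λ y → Cz n (q +ᶻ σ * j - val y)) ⟩
    Σ₄ (λ x y → Cz n (p - σ * j - val x) * Cz n (q +ᶻ σ * j - val y))
  ≡⟨ Σ₄-cong (λ x y → cong₂ _*_ (cong (Cz n) (reorder-p p (σ * j) (val x)))
                                 (cong (Cz n) (reorder-q q (σ * j) (val y)))) ⟩
    Σ₄ (λ x y → T n σ (p - val x) (q - val y) j) ∎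
  where
  open ≡-Reasoning
  reorder-p : ∀ p t v → p - t - v ≡ p - v - t
  reorder-p = solve-∀
  reorder-q : ∀ q t v → q +ᶻ t - v ≡ q - v +ᶻ t
  reorder-q = solve-∀

T-shift : ∀ n σ p q j → T n σ p q (j +ᶻ + 1) ≡ T n σ (p - σ) (q +ᶻ σ) j
T-shift n σ p q j = cong₂ _*_ (cong (Cz n) (shift-p p σ j)) (cong (Cz n) (shift-q q σ j))
  where
  shift-p : ∀ p σ j → p - σ * (j +ᶻ + 1) ≡ p - σ - σ * j
  shift-p = solve-∀
  shift-q : ∀ q σ j → q +ᶻ σ * (j +ᶻ + 1) ≡ q +ᶻ σ +ᶻ σ * j
  shift-q = solve-∀

T-even : ∀ n σ p q i → T n σ p q (i +ᶻ i) ≡ T n (σ +ᶻ σ) p q i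
T-even n σ p q i = cong₂ _*_ (cong (Cz n) (double-p p σ i)) (cong (Cz n) (double-q q σ i))
  where
  double-p : ∀ p σ i → p - σ * (i +ᶻ i) ≡ p - (σ +ᶻ σ) * i
  double-p = solve-∀
  double-q : ∀ q σ i → q +ᶻ σ * (i +ᶻ i) ≡ q +ᶻ (σ +ᶻ σ) * i
  double-q = solve-∀

T-odd : ∀ n σ p q i → T n σ p q (i +ᶻ i +ᶻ + 1) ≡ T n (σ +ᶻ σ) (p - σ) (q +ᶻ σ) i
T-odd n σ p q i = trans (T-shift n σ p q (i +ᶻ i)) (T-even n σ (p - σ) (q +ᶻ σ) i)

≤-abs : ∀ x → x ≤ᶻ + ∣ x ∣
≤-abs (+ n)    = ℤP.≤-refl
≤-abs -[1+ n ] = -≤+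

sub-neg : ∀ {x y} → x < y → x - y < + 0
sub-neg {x} {y} x<y = subst (x - y <_) (ℤP.+-inverseʳ y) (ℤP.+-monoˡ-< (- y) x<y)

below-multiple : ∀ s {x W m} → ∣ x ∣ ≤ W → W ℕ.< m → x - + (suc s ℕ.* m) < + 0
below-multiple s {x} {W} {m} x≤W W<m = sub-neg (ℤP.≤-<-trans (≤-abs x)
  (+<+ (ℕP.<-≤-trans (ℕP.≤-<-trans x≤W W<m) (ℕP.m≤m+n m (s ℕ.* m)))))

T-vanishes : ∀ n s p q W → 1 ≤ s → ∣ p ∣ ≤ W → ∣ q ∣ ≤ W → Supported W (T n (+ s) p q)
T-vanishes n (suc s) p q W _ p≤W q≤W (+ m) W<m =
  cong (_* Cz n (q +ᶻ + suc s * + m))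
       (Cz-neg n (subst (λ t → p - t < + 0) (ℤP.pos-* (suc s) m) (below-multiple s {p} p≤W W<m)))
T-vanishes n (suc s) p q W _ p≤W q≤W -[1+ m ] W<m =
  trans (cong (Cz n (p - + suc s * -[1+ m ]) *_)
              (Cz-neg n (subst (λ t → q +ᶻ t < + 0) negated (below-multiple s {q} q≤W W<m))))
        (ℤP.*-zeroʳ (Cz n (p - + suc s * -[1+ m ])))
  where
  negated : - + (suc s ℕ.* suc m) ≡ + suc s * -[1+ m ]
  negated = trans (cong -_ (ℤP.pos-* (suc s) (suc m))) (ℤP.neg-distribʳ-* (+ suc s) (+ suc m))

small-multiple : ∀ m j → ∣ + m * j ∣ ℕ.< m → j ≡ + 0
small-multiple m j small =
  ℤP.∣i∣≡0⇒i≡0 (vanishing-factor ∣ j ∣ (subst (ℕ._< m) (ℤP.abs-* (+ m) j) small))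
  where
  vanishing-factor : ∀ a → m ℕ.* a ℕ.< m → a ≡ 0
  vanishing-factor zero    _  = refl
  vanishing-factor (suc a) lt = ⊥-elim (ℕP.<⇒≱ lt (ℕP.m≤m*n m (suc a)))

-- At n = 0 the kernel is nonzero only where p - sj = 0 = q + sj, which forces
-- p - q = 2sj; if |p - q| < 2s this leaves only j = 0, and only when p = q.
T0-vanishes : ∀ s p q j → ∣ p - q ∣ ℕ.< s + s → ¬ (j ≡ + 0 × p - q ≡ + 0) → T 0 (+ s) p q j ≡ + 0
T0-vanishes s p q j small excluded with Cz-zero (p - + s * j) | Cz-zero (q +ᶻ + s * j)
... | inj₁ left≡0 | _            = cong (_* Cz 0 (q +ᶻ + s * j)) left≡0
... | inj₂ _      | inj₁ right≡0 =
  trans (cong (Cz 0 (p - + s * j) *_) right≡0) (ℤP.*-zeroʳ (Cz 0 (p - + s * j)))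
... | inj₂ p≡sj   | inj₂ q≡-sj   =
  ⊥-elim (excluded (j≡0 , trans p-q≡2sj (trans (cong (+ (s + s) *_) j≡0) (ℤP.*-zeroʳ (+ (s + s))))))
  where
  open ≡-Reasoning
  split : ∀ p q σ j → p - q ≡ p - σ * j - (q +ᶻ σ * j) +ᶻ (σ +ᶻ σ) * j
  split = solve-∀
  p-q≡2sj : p - q ≡ + (s + s) * j
  p-q≡2sj = begin
      p - q
    ≡⟨ split p q (+ s) j ⟩
      p - + s * j - (q +ᶻ + s * j) +ᶻ + (s + s) * j
    ≡⟨ cong₂ (λ x y → x - y +ᶻ + (s + s) * j) p≡sj q≡-sj ⟩
      + 0 +ᶻ + (s + s) * j
    ≡⟨ ℤP.+-identityˡ _ ⟩
      + (s + s) * j ∎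
  j≡0 : j ≡ + 0
  j≡0 = small-multiple (s + s) j (subst (λ x → ∣ x ∣ ℕ.< s + s) p-q≡2sj small)

double-even : ∀ i → ∣ i +ᶻ i ∣ ℕ.% 2 ≡ 0
double-even (+ n)    = trans (cong (ℕ._% 2) (twice n)) (ℕDM.[m+kn]%n≡m%n 0 n 2)
  where
  twice : ∀ n → n + n ≡ 0 + n ℕ.* 2
  twice = ℕSolver.solve-∀
double-even -[1+ n ] = trans (cong (ℕ._% 2) (twice n)) (ℕDM.[m+kn]%n≡m%n 0 (1 + n) 2)
  where
  twice : ∀ n → 2 + (n + n) ≡ 0 + (1 + n) ℕ.* 2
  twice = ℕSolver.solve-∀

double-odd : ∀ i → ∣ i +ᶻ i +ᶻ + 1 ∣ ℕ.% 2 ≡ 1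
double-odd (+ n)    = trans (cong (ℕ._% 2) (twice n)) (ℕDM.[m+kn]%n≡m%n 1 n 2)
  where
  twice : ∀ n → n + n + 1 ≡ 1 + n ℕ.* 2
  twice = ℕSolver.solve-∀
double-odd -[1+ n ] = trans (cong (λ z → ∣ z ∣ ℕ.% 2) (negative (+ n)))
                            (trans (cong (ℕ._% 2) (twice n)) (ℕDM.[m+kn]%n≡m%n 1 n 2))
  where
  negative : ∀ x → - (+ 1 +ᶻ x) +ᶻ - (+ 1 +ᶻ x) +ᶻ + 1 ≡ - (+ 1 +ᶻ (x +ᶻ x))
  negative = solve-∀
  twice : ∀ n → 1 + (n + n) ≡ 1 + n ℕ.* 2
  twice = ℕSolver.solve-∀

signℤ-even : ∀ l → ∣ l ∣ ℕ.% 2 ≡ 0 → signℤ l ≡ + 1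
signℤ-even l even with ∣ l ∣ ℕ.% 2 | even
... | zero  | _  = refl
... | suc _ | ()

signℤ-odd : ∀ l → ∣ l ∣ ℕ.% 2 ≡ 1 → signℤ l ≡ - + 1
signℤ-odd l odd with ∣ l ∣ ℕ.% 2 | odd
... | zero        | ()
... | suc zero    | _  = refl
... | suc (suc _) | ()

module Reflection (k : ℕ) where

  K : ℤ
  K = + k

  InBand : ℤ → Set
  InBand e = (- K < e) × (e < K)

  inBand? : ∀ e → Dec (InBand e)
  inBand? e = (- K ℤP.<? e) ×-dec (e ℤP.<? K)

  inBand-abs : ∀ {d} → InBand d → ∣ d ∣ ℕ.< k
  inBand-abs {+ n}       (_ , +<+ n<k) = n<k
  inBand-abs { -[1+ n ]} (-k<d , _) with subst (+ suc n <_) (ℤP.neg-involutive K) (ℤP.neg-mono-< -k<d)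
  ... | +<+ 1+n<k = 1+n<k

  -- For a walk at height d that still reads words with a and b
  -- ones, the kernel with step 2k minus its mirror image in the barrier k:
  --   D n a b d j = C(n, a-2kj) C(n, b+2kj) - C(n, a-k+d-2kj) C(n, b+k-d+2kj).
  D : ℕ → ℤ → ℤ → ℤ → ℤ → ℤ
  D n a b d j = T n (K +ᶻ K) a b j - T n (K +ᶻ K) (a - K +ᶻ d) (b +ᶻ K - d) j

  F : ℕ → ℕ → ℤ → ℤ → ℤ → ℤ
  F L n a b d = Σw L (D n a b d)

  -- Pascal's rule for D: the mirror image exchanges the moves (0,1) and (1,0)
  D-step : ∀ n a b d j →
    D (suc n) a b d j ≡ Σ₄ (λ x y → D n (a - val x) (b - val y) (d +ᶻ val x - val y) j)
  D-step n a b d j = begin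
      T (suc n) σ a b j - T (suc n) σ P Q j
    ≡⟨ cong₂ _-_ (T-pascal n σ a b j) (T-pascal n σ P Q j) ⟩
      Σ₄ (λ x y → T n σ (a - val x) (b - val y) j) - Σ₄ (λ x y → T n σ (P - val x) (Q - val y) j)
    ≡⟨ Σ₄-swap-sub (λ x y → T n σ (a - val x) (b - val y) j) (λ x y → T n σ (P - val x) (Q - val y) j) ⟩
      Σ₄ (λ x y → T n σ (a - val x) (b - val y) j - T n σ (P - val y) (Q - val x) j)
    ≡⟨ Σ₄-cong (λ x y → cong (_-_ (T n σ (a - val x) (b - val y) j))
                             (cong₂ (λ p q → T n σ p q j) (mirror-p a d K (val x) (val y))
                                                          (mirror-q b d K (val x) (val y)))) ⟩
      Σ₄ (λ x y → D n (a - val x) (b - val y) (d +ᶻ val x - val y) j) ∎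
    where
    open ≡-Reasoning
    σ = K +ᶻ K
    P = a - K +ᶻ d
    Q = b +ᶻ K - d
    mirror-p : ∀ a d K x y → a - K +ᶻ d - y ≡ a - x - K +ᶻ (d +ᶻ x - y)
    mirror-p = solve-∀
    mirror-q : ∀ b d K x y → b +ᶻ K - d - x ≡ b - y +ᶻ K - (d +ᶻ x - y)
    mirror-q = solve-∀

  F-step : ∀ L n a b d →
    F L (suc n) a b d ≡ Σ₄ (λ x y → F L n (a - val x) (b - val y) (d +ᶻ val x - val y))
  F-step L n a b d = trans (Σw-cong L (D-step n a b d))
    (Σ₄-commute {S = Σw L} (Σw-additive L) (λ j x y → D n (a - val x) (b - val y) (d +ᶻ val x - val y) j))

  -- on the upper barrier the mirror image is the kernel itself
  F-upper : ∀ L n a b → F L n a b K ≡ + 0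
  F-upper L n a b = trans (Σw-cong L cancels) (Σw-zero L)
    where
    back-p : ∀ a K → a - K +ᶻ K ≡ a
    back-p = solve-∀
    back-q : ∀ b K → b +ᶻ K - K ≡ b
    back-q = solve-∀
    cancels : ∀ j → D n a b K j ≡ + 0
    cancels j = trans
      (cong (_-_ (T n (K +ᶻ K) a b j)) (cong₂ (λ p q → T n (K +ᶻ K) p q j) (back-p a K) (back-q b K)))
      (ℤP.+-inverseʳ (T n (K +ᶻ K) a b j))

  -- on the lower barrier the mirror image is the kernel shifted by one index,
  -- so F is a telescoping sum
  F-lower : 1 ≤ k → ∀ L n a b → ∣ a ∣ + ∣ b ∣ ℕ.< L → F L n a b (- K) ≡ + 0
  F-lower 1≤k L n a b fits = trans (Σw-cong L shifted) (Σw-telescope (T n σ a b) supported fits)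
    where
    σ = K +ᶻ K
    supported : Supported (∣ a ∣ + ∣ b ∣) (T n σ a b)
    supported = T-vanishes n (k + k) a b (∣ a ∣ + ∣ b ∣) (ℕP.≤-trans 1≤k (ℕP.m≤m+n k k))
                           (ℕP.m≤m+n ∣ a ∣ ∣ b ∣) (ℕP.m≤n+m ∣ b ∣ ∣ a ∣)
    down : ∀ a K → a - K +ᶻ - K ≡ a - (K +ᶻ K)
    down = solve-∀
    up : ∀ b K → b +ᶻ K - - K ≡ b +ᶻ (K +ᶻ K)
    up = solve-∀
    shifted : ∀ j → D n a b (- K) j ≡ T n σ a b j - T n σ a b (j +ᶻ + 1)
    shifted j = cong (_-_ (T n σ a b j))
      (trans (cong₂ (λ p q → T n σ p q j) (down a K) (up b K)) (sym (T-shift n σ a b j)))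

  band-arith : ∀ {d e} → InBand d → ∣ e ∣ ≤ k →
    (∣ e - d ∣ ℕ.< (k + k) + (k + k)) × (∣ e +ᶻ d - (K +ᶻ K) ∣ ℕ.< (k + k) + (k + k)) ×
    (e +ᶻ d - (K +ᶻ K) < + 0)
  band-arith {d} {e} inBand e≤k = centre , mirror , below
    where
    ends : ∣ e ∣ + ∣ d ∣ ℕ.< k + k
    ends = ℕP.+-mono-≤-< e≤k (inBand-abs inBand)
    centre : ∣ e - d ∣ ℕ.< (k + k) + (k + k)
    centre = ℕP.<-≤-trans (ℕP.≤-<-trans (ℤP.∣i-j∣≤∣i∣+∣j∣ e d) ends) (ℕP.m≤m+n (k + k) (k + k))
    mirror : ∣ e +ᶻ d - (K +ᶻ K) ∣ ℕ.< (k + k) + (k + k)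
    mirror = ℕP.≤-<-trans (ℤP.∣i-j∣≤∣i∣+∣j∣ (e +ᶻ d) (K +ᶻ K))
                          (ℕP.+-monoˡ-< (k + k) (ℕP.≤-<-trans (ℤP.∣i+j∣≤∣i∣+∣j∣ e d) ends))
    below : e +ᶻ d - (K +ᶻ K) < + 0
    below = sub-neg (ℤP.+-mono-≤-< (ℤP.≤-trans (≤-abs e) (+≤+ e≤k)) (proj₂ inBand))

  -- for n = 0 only the term j = 0 of the kernel survives, and the mirror image
  -- vanishes, provided the start d lies in the open band and the end d + a - b in
  -- the closed one
  F-base : ∀ L a b d → InBand d → ∣ d +ᶻ a - b ∣ ≤ k → F L 0 a b d ≡ Cz 0 a * Cz 0 b
  F-base L a b d inBand end = begin
      Σw L (D 0 a b d)
    ≡⟨ Σw-window (D 0 a b d) supported z≤n ⟩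
      T 0 σ a b (+ 0) - T 0 σ P Q (+ 0) +ᶻ + 0
    ≡⟨ cong (λ t → T 0 σ a b (+ 0) - t +ᶻ + 0) (mirror-vanishes (+ 0)) ⟩
      T 0 σ a b (+ 0) +ᶻ + 0 +ᶻ + 0
    ≡⟨ trans (ℤP.+-identityʳ _) (ℤP.+-identityʳ _) ⟩
      Cz 0 (a - σ * + 0) * Cz 0 (b +ᶻ σ * + 0)
    ≡⟨ cong₂ (λ p q → Cz 0 p * Cz 0 q) (at-zero-p a σ) (at-zero-q b σ) ⟩
      Cz 0 a * Cz 0 b ∎
    where
    open ≡-Reasoning
    σ = K +ᶻ K
    P = a - K +ᶻ d
    Q = b +ᶻ K - d
    at-zero-p : ∀ a σ → a - σ * + 0 ≡ a
    at-zero-p = solve-∀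
    at-zero-q : ∀ b σ → b +ᶻ σ * + 0 ≡ b
    at-zero-q = solve-∀
    centred : ∀ d a b → d +ᶻ a - b - d ≡ a - b
    centred = solve-∀
    mirrored : ∀ d a b K → d +ᶻ a - b +ᶻ d - (K +ᶻ K) ≡ a - K +ᶻ d - (b +ᶻ K - d)
    mirrored = solve-∀
    bounds = band-arith {d} {d +ᶻ a - b} inBand end
    mirror-vanishes : ∀ j → T 0 σ P Q j ≡ + 0
    mirror-vanishes j = T0-vanishes (k + k) P Q j
      (subst (λ x → ∣ x ∣ ℕ.< (k + k) + (k + k)) (mirrored d a b K) (proj₁ (proj₂ bounds)))
      (λ { (_ , P-Q≡0) → ℤP.<-irrefl P-Q≡0 (subst (_< + 0) (mirrored d a b K) (proj₂ (proj₂ bounds))) })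
    supported : Supported 0 (D 0 a b d)
    supported j 0<∣j∣ = cong₂ _-_
      (T0-vanishes (k + k) a b j
        (subst (λ x → ∣ x ∣ ℕ.< (k + k) + (k + k)) (centred d a b) (proj₁ bounds))
        (λ { (j≡0 , _) → ℕP.<-irrefl (sym (cong ∣_∣ j≡0)) 0<∣j∣ }))
      (mirror-vanishes j)

  Stays : ∀ {m n} → ℤ → Vec Bool m → Vec Bool n → Set
  Stays d (x ∷ u) (y ∷ v) = InBand (d +ᶻ val x - val y) × Stays (d +ᶻ val x - val y) u v
  Stays d _       _       = ⊤

  stays? : ∀ {m n} d (u : Vec Bool m) (v : Vec Bool n) → Dec (Stays d u v)
  stays? d (x ∷ u) (y ∷ v) = inBand? (d +ᶻ val x - val y) ×-dec stays? (d +ᶻ val x - val y) u v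
  stays? d []      v       = yes tt
  stays? d (x ∷ u) []      = yes tt

  Walk : ∀ {m n} → ℤ → ℤ → ℤ → Vec Bool m → Vec Bool n → Set
  Walk a b d u v = (+ ones u ≡ a) × (+ ones v ≡ b) × Stays d u v

  walk? : ∀ {m n} a b d (u : Vec Bool m) (v : Vec Bool n) → Dec (Walk a b d u v)
  walk? a b d u v = (+ ones u ℤP.≟ a) ×-dec ((+ ones v ℤP.≟ b) ×-dec stays? d u v)

  walks : ℕ → ℤ → ℤ → ℤ → ℤ
  walks n a b d = Σl (allWords n) (λ u → Σl (allWords n) (λ v → ind (walk? a b d u v)))

  ind-walk-∷ : ∀ {m n} a b d x y (u : Vec Bool m) (v : Vec Bool n) →
    ind (walk? a b d (x ∷ u) (y ∷ v)) ≡
    ind (inBand? (d +ᶻ val x - val y)) * ind (walk? (a - val x) (b - val y) (d +ᶻ val x - val y) u v)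
  ind-walk-∷ a b d x y u v =
    trans (ind-⇔ to from (walk? a b d (x ∷ u) (y ∷ v)) (inBand? d' ×-dec walk? (a - val x) (b - val y) d' u v))
          (ind-× (inBand? d') (walk? (a - val x) (b - val y) d' u v))
    where
    d' = d +ᶻ val x - val y
    ones-∷ : ∀ {m} z (w : Vec Bool m) → + ones (z ∷ w) ≡ val z +ᶻ + ones w
    ones-∷ true  w = refl
    ones-∷ false w = refl
    drop : ∀ v w → v +ᶻ w - v ≡ w
    drop = solve-∀
    restore : ∀ v c → v +ᶻ (c - v) ≡ c
    restore = solve-∀
    rest : ∀ {m} z (w : Vec Bool m) c → + ones (z ∷ w) ≡ c → + ones w ≡ c - val z
    rest z w c eq = trans (sym (drop (val z) (+ ones w))) (cong (_- val z) (trans (sym (ones-∷ z w)) eq))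
    whole : ∀ {m} z (w : Vec Bool m) c → + ones w ≡ c - val z → + ones (z ∷ w) ≡ c
    whole z w c eq = trans (ones-∷ z w) (trans (cong (val z +ᶻ_) eq) (restore (val z) c))
    to : Walk a b d (x ∷ u) (y ∷ v) → InBand d' × Walk (a - val x) (b - val y) d' u v
    to (onesᵤ , onesᵥ , step , stays) = step , rest x u a onesᵤ , rest y v b onesᵥ , stays
    from : InBand d' × Walk (a - val x) (b - val y) d' u v → Walk a b d (x ∷ u) (y ∷ v)
    from (step , onesᵤ , onesᵥ , stays) = whole x u a onesᵤ , whole y v b onesᵥ , step , stays

  walks-step : ∀ n a b d → walks (suc n) a b d ≡
    Σ₄ (λ x y → ind (inBand? (d +ᶻ val x - val y)) * walks n (a - val x) (b - val y) (d +ᶻ val x - val y))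
  walks-step n a b d = begin
      Σl (allWords (suc n)) (λ u → Σl (allWords (suc n)) (λ v → E u v))
    ≡⟨ Σl-cong (allWords (suc n)) (λ u → Σl-allWords n (E u)) ⟩
      Σl (allWords (suc n)) (λ u → Σ₂ (λ y → Σl (allWords n) (λ v → E u (y ∷ v))))
    ≡⟨ Σl-allWords n _ ⟩
      Σ₂ (λ x → Σl (allWords n) (λ u → Σ₂ (λ y → Σl (allWords n) (λ v → E (x ∷ u) (y ∷ v)))))
    ≡⟨ Σ₂-cong (λ x → Σ₂-commute {S = Σl (allWords n)} (Σl-additive (allWords n))
                                 (λ u y → Σl (allWords n) (λ v → E (x ∷ u) (y ∷ v)))) ⟩
      Σ₄ (λ x y → Σl (allWords n) (λ u → Σl (allWords n) (λ v → E (x ∷ u) (y ∷ v))))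
    ≡⟨ Σ₄-cong first-step ⟩
      Σ₄ (λ x y → ind (inBand? (d +ᶻ val x - val y)) * walks n (a - val x) (b - val y) (d +ᶻ val x - val y)) ∎
    where
    open ≡-Reasoning
    E : ∀ {m} → Vec Bool m → Vec Bool m → ℤ
    E u v = ind (walk? a b d u v)
    first-step : ∀ x y →
      Σl (allWords n) (λ u → Σl (allWords n) (λ v → E (x ∷ u) (y ∷ v))) ≡
      ind (inBand? (d +ᶻ val x - val y)) * walks n (a - val x) (b - val y) (d +ᶻ val x - val y)
    first-step x y = trans
      (Σl-cong (allWords n) (λ u → trans (Σl-cong (allWords n) (ind-walk-∷ a b d x y u))
                                         (Σl-scale (allWords n) c (λ v → ind (walk? a' b' d' u v)))))
      (Σl-scale (allWords n) c (λ u → Σl (allWords n) (λ v → ind (walk? a' b' d' u v))))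
      where
      a' = a - val x
      b' = b - val y
      d' = d +ᶻ val x - val y
      c = ind (inBand? d')

  walks-base : ∀ a b d → walks 0 a b d ≡ Cz 0 a * Cz 0 b
  walks-base a b d = begin
      ind (walk? a b d [] []) +ᶻ + 0 +ᶻ + 0
    ≡⟨ trans (ℤP.+-identityʳ _) (ℤP.+-identityʳ _) ⟩
      ind (walk? a b d [] [])
    ≡⟨ trans (ind-× (+ 0 ℤP.≟ a) ((+ 0 ℤP.≟ b) ×-dec yes tt))
             (cong (ind (+ 0 ℤP.≟ a) *_) (ind-× (+ 0 ℤP.≟ b) (yes tt))) ⟩
      ind (+ 0 ℤP.≟ a) * (ind (+ 0 ℤP.≟ b) * + 1)
    ≡⟨ cong (ind (+ 0 ℤP.≟ a) *_) (ℤP.*-identityʳ _) ⟩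
      ind (+ 0 ℤP.≟ a) * ind (+ 0 ℤP.≟ b)
    ≡⟨ sym (cong₂ _*_ (Cz0-ind a) (Cz0-ind b)) ⟩
      Cz 0 a * Cz 0 b ∎
    where
    open ≡-Reasoning
    Cz0-ind : ∀ a → Cz 0 a ≡ ind (+ 0 ℤP.≟ a)
    Cz0-ind (+ zero)  = sym (ind-yes refl (+ 0 ℤP.≟ + 0))
    Cz0-ind (+ suc m) = sym (ind-no (λ ()) (+ 0 ℤP.≟ + suc m))
    Cz0-ind -[1+ m ]  = sym (ind-no (λ ()) (+ 0 ℤP.≟ -[1+ m ]))

  level : ∀ d v → d +ᶻ v - v ≡ d
  level = solve-∀

  -- one step changes the height by at most one, so a walk leaving the open band
  -- lands exactly on one of its barriers

  exit : ∀ {d} → InBand d → ∀ x y → ¬ InBand (d +ᶻ val x - val y) →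
         (d +ᶻ val x - val y ≡ K) ⊎ (d +ᶻ val x - val y ≡ - K)
  exit {d} inBand false false out = ⊥-elim (out (subst InBand (sym (level d (+ 0))) inBand))
  exit {d} inBand true  true  out = ⊥-elim (out (subst InBand (sym (level d (+ 1))) inBand))
  exit {d} (-K<d , d<K) true false out = inj₁ (trans (up d)
    (ℤP.≤-antisym (ℤP.i<j⇒suc[i]≤j d<K)
                  (ℤP.≮⇒≥ λ up<K → out (subst InBand (sym (up d))
                                              (ℤP.<-≤-trans -K<d (ℤP.i≤suc[i] d) , up<K)))))
    where
    up : ∀ d → d +ᶻ + 1 - + 0 ≡ + 1 +ᶻ d
    up = solve-∀
  exit {d} (-K<d , d<K) false true out = inj₂ (trans (down d)
    (ℤP.≤-antisym (ℤP.≮⇒≥ λ -K<down → out (subst InBand (sym (down d))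
                                              (-K<down , ℤP.≤-<-trans (ℤP.i≤j⇒pred[i]≤j ℤP.≤-refl) d<K)))
                  (ℤP.i<j⇒i≤pred[j] -K<d)))
    where
    down : ∀ d → d +ᶻ + 0 - + 1 ≡ - + 1 +ᶻ d
    down = solve-∀

  remove-letter : ∀ c z → ∣ c - val z ∣ ≤ suc ∣ c ∣
  remove-letter c z = ℕP.≤-trans (ℤP.∣i-j∣≤∣i∣+∣j∣ c (val z))
    (ℕP.≤-trans (ℕP.+-monoʳ-≤ ∣ c ∣ (letter≤1 z)) (ℕP.≤-reflexive (ℕP.+-comm ∣ c ∣ 1)))
    where
    letter≤1 : ∀ z → ∣ val z ∣ ≤ 1
    letter≤1 true  = s≤s z≤n
    letter≤1 false = z≤n

  -- The main induction: the number of walks equals F, provided the start lies in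
  -- the open band, the end d + a - b in the closed band, and the window L exceeds
  -- everything the remaining n steps can reach.
  walks≡F : 1 ≤ k → ∀ n a b d L → InBand d → ∣ d +ᶻ a - b ∣ ≤ k →
            ∣ a ∣ + ∣ b ∣ + 2 ℕ.* n ℕ.< L → walks n a b d ≡ F L n a b d
  walks≡F 1≤k zero    a b d L inBand end _ = trans (walks-base a b d) (sym (F-base L a b d inBand end))
  walks≡F 1≤k (suc n) a b d L inBand end fits = begin
      walks (suc n) a b d
    ≡⟨ walks-step n a b d ⟩
      Σ₄ (λ x y → ind (inBand? (d +ᶻ val x - val y)) * walks n (a - val x) (b - val y) (d +ᶻ val x - val y))
    ≡⟨ Σ₄-cong step ⟩
      Σ₄ (λ x y → F L n (a - val x) (b - val y) (d +ᶻ val x - val y))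
    ≡⟨ sym (F-step L n a b d) ⟩
      F L (suc n) a b d ∎
    where
    open ≡-Reasoning
    same-end : ∀ d a b x y → d +ᶻ x - y +ᶻ (a - x) - (b - y) ≡ d +ᶻ a - b
    same-end = solve-∀
    regroup : ∀ p q n → suc p + suc q + 2 ℕ.* n ≡ p + q + 2 ℕ.* suc n
    regroup = ℕSolver.solve-∀
    fits′ : ∀ x y → ∣ a - val x ∣ + ∣ b - val y ∣ + 2 ℕ.* n ℕ.< L
    fits′ x y = ℕP.≤-<-trans
      (ℕP.≤-trans (ℕP.+-monoˡ-≤ (2 ℕ.* n) (ℕP.+-mono-≤ (remove-letter a x) (remove-letter b y)))
                  (ℕP.≤-reflexive (regroup ∣ a ∣ ∣ b ∣ n)))
      fits
    step : ∀ x y → ind (inBand? (d +ᶻ val x - val y)) * walks n (a - val x) (b - val y) (d +ᶻ val x - val y)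
                   ≡ F L n (a - val x) (b - val y) (d +ᶻ val x - val y)
    step x y with inBand? (d +ᶻ val x - val y)
    ... | yes inside = trans (ℤP.*-identityˡ _)
      (walks≡F 1≤k n (a - val x) (b - val y) (d +ᶻ val x - val y) L inside
               (subst (λ t → ∣ t ∣ ≤ k) (sym (same-end d a b (val x) (val y))) end) (fits′ x y))
    ... | no outside with exit inBand x y outside
    ...   | inj₁ on-top    = sym (trans (cong (F L n (a - val x) (b - val y)) on-top)
                                        (F-upper L n (a - val x) (b - val y)))
    ...   | inj₂ on-bottom = sym (trans (cong (F L n (a - val x) (b - val y)) on-bottom)
                                        (F-lower 1≤k L n (a - val x) (b - val y)
                                                 (ℕP.≤-<-trans (ℕP.m≤m+n _ (2 ℕ.* n)) (fits′ x y))))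

  psum-zero : ∀ u v → psum u v 0 ≡ + 0
  psum-zero []      v       = refl
  psum-zero (x ∷ u) []      = refl
  psum-zero (x ∷ u) (y ∷ v) = refl

  first-sum : ∀ d x y u v → d +ᶻ psum (x ∷ u) (y ∷ v) 1 ≡ d +ᶻ val x - val y
  first-sum d x y u v = trans (cong (λ t → d +ᶻ (val x - val y +ᶻ t)) (psum-zero u v)) (no-tail d (val x) (val y))
    where
    no-tail : ∀ d x y → d +ᶻ (x - y +ᶻ + 0) ≡ d +ᶻ x - y
    no-tail = solve-∀

  later-sum : ∀ d x y u v s →
    d +ᶻ psum (x ∷ u) (y ∷ v) (suc (suc s)) ≡ d +ᶻ val x - val y +ᶻ psum u v (suc s)
  later-sum d x y u v s = shift d (val x) (val y) (psum u v (suc s))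
    where
    shift : ∀ d x y p → d +ᶻ (x - y +ᶻ p) ≡ d +ᶻ x - y +ᶻ p
    shift = solve-∀

  -- partial sums in the band (offset by d) amount to Stays d; the converse direction
  -- needs words of equal length, since psum stops at the end of the shorter word
  stays-from-sums : ∀ {m n} d (u : Vec Bool m) (v : Vec Bool n) →
    (∀ {s} → s ℕ.< m → InBand (d +ᶻ psum (toList u) (toList v) (suc s))) → Stays d u v
  stays-from-sums d (x ∷ u) (y ∷ v) sums =
    subst InBand (first-sum d x y (toList u) (toList v)) (sums (s≤s z≤n)) ,
    stays-from-sums (d +ᶻ val x - val y) u v
      (λ {s} s<m → subst InBand (later-sum d x y (toList u) (toList v) s) (sums (s≤s s<m)))
  stays-from-sums d []      v       sums = tt
  stays-from-sums d (x ∷ u) []      sums = tt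

  sums-from-stays : ∀ {m n} d (u : Vec Bool m) (v : Vec Bool n) → m ≡ n → Stays d u v →
    ∀ {s} → s ℕ.< m → InBand (d +ᶻ psum (toList u) (toList v) (suc s))
  sums-from-stays d (x ∷ u) (y ∷ v) m≡n (step , stays) {zero} _ =
    subst InBand (sym (first-sum d x y (toList u) (toList v))) step
  sums-from-stays d (x ∷ u) (y ∷ v) m≡n (step , stays) {suc s} (s≤s s<m) =
    subst InBand (sym (later-sum d x y (toList u) (toList v) s))
          (sums-from-stays (d +ᶻ val x - val y) u v (ℕP.suc-injective m≡n) stays s<m)
  sums-from-stays d (x ∷ u) [] () stays

  good⇔walk : ∀ M N (u : Vec Bool (M + N)) (v : Vec Bool (N + M)) →
    ind (good? M N k (u , v)) ≡ ind (walk? (+ M) (+ N) (+ 0) u v)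
  good⇔walk M N u v = ind-⇔ to from (good? M N k (u , v)) (walk? (+ M) (+ N) (+ 0) u v)
    where
    P : ℕ → Set
    P s = InBand (psum (toList u) (toList v) s)
    bounded⇒ : Bounded k (M + N) (toList u) (toList v) → ∀ {s} → s ℕ.< M + N → P (suc s)
    bounded⇒ bounded = AllP.applyUpTo⁻ suc (M + N) (subst (All P) (ListP.map-upTo suc (M + N)) bounded)
    ⇒bounded : (∀ {s} → s ℕ.< M + N → P (suc s)) → Bounded k (M + N) (toList u) (toList v)
    ⇒bounded sums = subst (All P) (sym (ListP.map-upTo suc (M + N))) (AllP.applyUpTo⁺₁ suc (M + N) sums)
    to : Good M N k (u , v) → Walk (+ M) (+ N) (+ 0) u v
    to (onesᵤ , onesᵥ , bounded) = cong +_ onesᵤ , cong +_ onesᵥ ,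
      stays-from-sums (+ 0) u v (λ s<m → subst InBand (sym (ℤP.+-identityˡ _)) (bounded⇒ bounded s<m))
    from : Walk (+ M) (+ N) (+ 0) u v → Good M N k (u , v)
    from (onesᵤ , onesᵥ , stays) = ℤP.+-injective onesᵤ , ℤP.+-injective onesᵥ ,
      ⇒bounded (λ s<m → subst InBand (ℤP.+-identityˡ _) (sums-from-stays (+ 0) u v (ℕP.+-comm M N) stays s<m))

  count≡walks : ∀ M N → + count M N k ≡ walks (M + N) (+ M) (+ N) (+ 0)
  count≡walks M N = begin
      + count M N k
    ≡⟨ length-filter (good? M N k) (List.cartesianProduct (allWords (M + N)) (allWords (N + M))) ⟩
      Σl (List.cartesianProduct (allWords (M + N)) (allWords (N + M))) (λ p → ind (good? M N k p))
    ≡⟨ Σl-cartesianProduct (allWords (M + N)) (allWords (N + M)) (λ p → ind (good? M N k p)) ⟩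
      Σl (allWords (M + N)) (λ u → Σl (allWords (N + M)) (λ v → ind (good? M N k (u , v))))
    ≡⟨ Σl-cong (allWords (M + N)) (λ u → Σl-cong (allWords (N + M)) (good⇔walk M N u)) ⟩
      Σl (allWords (M + N)) (λ u → Σl (allWords (N + M)) (λ v → ind (walk? (+ M) (+ N) (+ 0) u v)))
    ≡⟨ cong (λ n → Σl (allWords (M + N)) (λ u → Σl (allWords n) (λ v → ind (walk? (+ M) (+ N) (+ 0) u v))))
            (ℕP.+-comm N M) ⟩
      walks (M + N) (+ M) (+ N) (+ 0) ∎
    where open ≡-Reasoning

  -- Translation of the sum side: by the symmetry C(M+N, N + kl) = C(M+N, M - kl)
  -- the summand of the statement is the kernel with step k, times (-1)^l.
  term≡T : ∀ M N l → term M N k l ≡ T (M + N) K (+ M) (+ N) l * signℤ l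
  term≡T M N l = cong (λ c → Cz (M + N) (+ M - K * l) * c * signℤ l)
    (sym (trans (Cz-sym (M + N) (+ N +ᶻ K * l)) (cong (Cz (M + N)) (complement (+ M) (+ N) (K * l)))))
    where
    complement : ∀ M N y → M +ᶻ N - (N +ᶻ y) ≡ M - y
    complement = solve-∀

  term-supported : 1 ≤ k → ∀ M N → Supported (M + N) (term M N k)
  term-supported 1≤k M N l outside = begin
      term M N k l
    ≡⟨ term≡T M N l ⟩
      T (M + N) K (+ M) (+ N) l * signℤ l
    ≡⟨ cong (_* signℤ l) (T-vanishes (M + N) k (+ M) (+ N) (M + N) 1≤k
                                     (ℕP.m≤m+n M N) (ℕP.m≤n+m N M) l outside) ⟩
      + 0 * signℤ l
    ≡⟨ ℤP.*-zeroˡ (signℤ l) ⟩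
      + 0 ∎
    where open ≡-Reasoning

  paired-terms : ∀ M N i →
    term M N k (i +ᶻ i) +ᶻ term M N k (i +ᶻ i +ᶻ + 1) ≡ D (M + N) (+ M) (+ N) (+ 0) i
  paired-terms M N i = begin
      term M N k (i +ᶻ i) +ᶻ term M N k (i +ᶻ i +ᶻ + 1)
    ≡⟨ cong₂ _+ᶻ_ (term≡T M N (i +ᶻ i)) (term≡T M N (i +ᶻ i +ᶻ + 1)) ⟩
      T n K (+ M) (+ N) (i +ᶻ i) * signℤ (i +ᶻ i)
        +ᶻ T n K (+ M) (+ N) (i +ᶻ i +ᶻ + 1) * signℤ (i +ᶻ i +ᶻ + 1)
    ≡⟨ cong₂ _+ᶻ_ (cong₂ _*_ (T-even n K (+ M) (+ N) i) (signℤ-even (i +ᶻ i) (double-even i)))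
                  (cong₂ _*_ (T-odd n K (+ M) (+ N) i) (signℤ-odd (i +ᶻ i +ᶻ + 1) (double-odd i))) ⟩
      T n σ (+ M) (+ N) i * + 1 +ᶻ T n σ (+ M - K) (+ N +ᶻ K) i * - + 1
    ≡⟨ signed-difference (T n σ (+ M) (+ N) i) (T n σ (+ M - K) (+ N +ᶻ K) i) ⟩
      T n σ (+ M) (+ N) i - T n σ (+ M - K) (+ N +ᶻ K) i
    ≡⟨ cong (_-_ (T n σ (+ M) (+ N) i))
            (cong₂ (λ p q → T n σ p q i) (sym (ℤP.+-identityʳ (+ M - K))) (sym (ℤP.+-identityʳ (+ N +ᶻ K)))) ⟩
      D n (+ M) (+ N) (+ 0) i ∎
    where
    open ≡-Reasoning
    n = M + N
    σ = K +ᶻ K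
    signed-difference : ∀ a b → a * + 1 +ᶻ b * - + 1 ≡ a - b
    signed-difference = solve-∀

  symSum≡F : 1 ≤ k → ∀ M N L R → M + N ≤ L → M + N ≤ R →
    symSum L (term M N k) ≡ F R (M + N) (+ M) (+ N) (+ 0)
  symSum≡F 1≤k M N L R M+N≤L M+N≤R = begin
      symSum L h
    ≡⟨ symSum≡Σw L h ⟩
      Σw L h
    ≡⟨ Σw-window h supported M+N≤L ⟩
      Σw (M + N) h
    ≡⟨ sym (Σw-window h supported (ℕP.≤-trans M+N≤R (ℕP.≤-trans (ℕP.m≤m+n R R) (ℕP.n≤1+n (R + R))))) ⟩
      Σw (suc (R + R)) h
    ≡⟨ Σw-pairs R h ⟩
      h (- + suc (R + R)) +ᶻ Σw R (λ i → h (i +ᶻ i) +ᶻ h (i +ᶻ i +ᶻ + 1))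
    ≡⟨ cong (_+ᶻ Σw R (λ i → h (i +ᶻ i) +ᶻ h (i +ᶻ i +ᶻ + 1)))
            (supported (- + suc (R + R)) (s≤s (ℕP.≤-trans M+N≤R (ℕP.m≤m+n R R)))) ⟩
      + 0 +ᶻ Σw R (λ i → h (i +ᶻ i) +ᶻ h (i +ᶻ i +ᶻ + 1))
    ≡⟨ ℤP.+-identityˡ _ ⟩
      Σw R (λ i → h (i +ᶻ i) +ᶻ h (i +ᶻ i +ᶻ + 1))
    ≡⟨ Σw-cong R (paired-terms M N) ⟩
      F R (M + N) (+ M) (+ N) (+ 0) ∎
    where
    open ≡-Reasoning
    h = term M N k
    supported = term-supported 1≤k M N

proposition2p1 : (M N k : ℕ) → 1 ≤ k → ∣ + M - + N ∣ ≤ k →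
    (L : ℕ) → M + N ≤ L →
    + (count M N k) ≡ symSum L (term M N k)
proposition2p1 M N k 1≤k end L M+N≤L = begin
    + count M N k
  ≡⟨ count≡walks M N ⟩
    walks (M + N) (+ M) (+ N) (+ 0)
  ≡⟨ walks≡F 1≤k (M + N) (+ M) (+ N) (+ 0) R start end (ℕP.n<1+n _) ⟩
    F R (M + N) (+ M) (+ N) (+ 0)
  ≡⟨ sym (symSum≡F 1≤k M N L R M+N≤L (ℕP.m≤n⇒m≤1+n (ℕP.m≤m+n (M + N) (2 ℕ.* (M + N))))) ⟩
    symSum L (term M N k) ∎
  where
  open Reflection k
  open ≡-Reasoning
  R = suc (M + N + 2 ℕ.* (M + N))
  start : InBand (+ 0)
  start = ℤP.neg-mono-< (+<+ 1≤k) , +<+ 1≤k
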